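{- For every (possibly open) plain term $t$ and variable $k\notin\mathrm{fv}(t)$: $t\approx_o\mathcal{S}k.(k\,t)$.
   Context: Plain calculus $\lambda_S$: terms $t ::= v \mid t\,t \mid \mathcal{S}k.t \mid \langle t\rangle$, values $v ::= x \mid \lambda x.t$; pure contexts $E ::= \square \mid v\,E \mid E\,t$; evaluation contexts $F ::= \square \mid v\,F \mid F\,t \mid \langle F\rangle$. Extended calculus: context variables $\alpha$; terms add $\alpha\langle t\rangle$ (a new construct, $\alpha$ standing for an unknown delimited context); evaluation contexts add $\alpha\langle F\rangle$; delimited contexts $D ::= \langle E\rangle\mid\alpha\langle E\rangle$ (every evaluation context is pure or uniquely $F[D]$). Reduction: $F[(\lambda x.t)\,v] \to F[t\{v/x\}]$; $F[D[\mathcal{S}k.t]]\to F[\langle t\{\lambda x.D[x]/k\}\rangle]$ ($x\notin\mathrm{fv}(D)$); $F[\langle v\rangle]\to F[v]$. Normal forms: values, open-stuck $F[x\,v]$, control-stuck $E[\mathcal{S}k.t]$, context-stuck $F[\alpha\langle v\rangle]$; $t\Downarrow t'$: $t\to^*t'$, $t'$ normal form. Pure terms $p ::= v\mid\langle t\rangle\mid\alpha\langle t\rangle$. Extensions of $R$ ($x$, $\alpha$ fresh): $F_0[D_0]\,R^c\,F_1[D_1]$ iff $D_0[x]\,R\,D_1[x]$ and $F_0[x]\,R\,F_1[x]$; $v_0\,R^v\,v_1$ iff $\alpha\langle v_0\,x\rangle\,R\,\alpha\langle v_1\,x\rangle$; $F_0[y\,v_0]\,R^{nf}\,F_1[y\,v_1]$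 iff $F_0\,R^c\,F_1$ and $v_0\,R^v\,v_1$. A pure normal-form bisimulation is a relation $R$ on open extended pure terms such that $p_0\,R\,p_1$ implies: $p_0\to p_0'$ gives $p_1\to^*p_1'$ with $p_0'\,R\,p_1'$; $p_0$ value gives $p_1\Downarrow v_1$ with $p_0\,R^v\,v_1$; if $p_0=F_0[\alpha\langle v_0\rangle]$ then $p_1\Downarrow F_1[\alpha\langle v_1\rangle]$ with $F_0[\langle\square\rangle]\,R^c\,F_1[\langle\square\rangle]$ and $v_0\,R^v\,v_1$; if $p_0$ is open-stuck then $p_1\Downarrow p_1'$ with $p_0\,R^{nf}\,p_1'$; and symmetrically. $\approx_o$ is the largest one, extended to arbitrary terms by: $t_0\approx_o t_1$ iff $\alpha\langle t_0\rangle\approx_o\alpha\langle t_1\rangle$ for a fresh $\alpha$. -}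

module Defs where

open import Level using (0ℓ)
open import Data.Nat using (ℕ; zero; suc)
open import Data.Fin using (Fin; zero; suc)
open import Data.Product using (Σ; ∃; ∃₂; _×_; _,_)
open import Data.Sum using (_⊎_)
open import Data.Unit using (⊤)
open import Data.Empty using (⊥)
open import Relation.Nullary using (¬_)
open import Relation.Binary.PropositionalEquality using (_≡_; _≢_)
open import Relation.Binary.Construct.Closure.ReflexiveTransitive using (Star)

-- Syntax of the extended calculus (well-scoped de Bruijn for term
-- variables; context variables α are names in ℕ, never bound).
--   values v ::= x | λx.t
--   terms  t ::= v | t t | S k.t | ⟨t⟩ | α⟨t⟩

mutual
  data Val (n : ℕ) : Set where
    var : Fin n → Val n
    lam : Tm (suc n) → Val n

  data Tm (n : ℕ) : Set where
    val : Val n → Tm n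
    app : Tm n → Tm n → Tm n
    sft : Tm (suc n) → Tm n
    rst : Tm n → Tm n
    cv  : ℕ → Tm n → Tm n

Ren : ℕ → ℕ → Set
Ren n m = Fin n → Fin m

ext : ∀ {n m} → Ren n m → Ren (suc n) (suc m)
ext ρ zero    = zero
ext ρ (suc i) = suc (ρ i)

mutual
  renV : ∀ {n m} → Ren n m → Val n → Val m
  renV ρ (var x) = var (ρ x)
  renV ρ (lam t) = lam (renT (ext ρ) t)

  renT : ∀ {n m} → Ren n m → Tm n → Tm m
  renT ρ (val v)   = val (renV ρ v)
  renT ρ (app s t) = app (renT ρ s) (renT ρ t)
  renT ρ (sft t)   = sft (renT (ext ρ) t)
  renT ρ (rst t)   = rst (renT ρ t)
  renT ρ (cv α t)  = cv α (renT ρ t)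

wkV : ∀ {n} → Val n → Val (suc n)
wkV = renV suc

wkT : ∀ {n} → Tm n → Tm (suc n)
wkT = renT suc

Sub : ℕ → ℕ → Set
Sub n m = Fin n → Val m

exts : ∀ {n m} → Sub n m → Sub (suc n) (suc m)
exts σ zero    = var zero
exts σ (suc i) = wkV (σ i)

mutual
  subV : ∀ {n m} → Sub n m → Val n → Val m
  subV σ (var x) = σ x
  subV σ (lam t) = lam (subT (exts σ) t)

  subT : ∀ {n m} → Sub n m → Tm n → Tm m
  subT σ (val v)   = val (subV σ v)
  subT σ (app s t) = app (subT σ s) (subT σ t)
  subT σ (sft t)   = sft (subT (exts σ) t)
  subT σ (rst t)   = rst (subT σ t)
  subT σ (cv α t)  = cv α (subT σ t)

sub0 : ∀ {n} → Val n → Sub (suc n) n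
sub0 v zero    = v
sub0 v (suc i) = var i

_[_]₀ : ∀ {n} → Tm (suc n) → Val n → Tm n
t [ v ]₀ = subT (sub0 v) t

data ECtx (n : ℕ) : Set where
  □    : ECtx n
  appR : Val n → ECtx n → ECtx n
  appL : ECtx n → Tm n → ECtx n

data FCtx (n : ℕ) : Set where
  □    : FCtx n
  appR : Val n → FCtx n → FCtx n
  appL : FCtx n → Tm n → FCtx n
  rst  : FCtx n → FCtx n
  cv   : ℕ → FCtx n → FCtx n

data DCtx (n : ℕ) : Set where
  rst : ECtx n → DCtx n
  cv  : ℕ → ECtx n → DCtx n

plugE : ∀ {n} → ECtx n → Tm n → Tm n
plugE □          t = t
plugE (appR v E) t = app (val v) (plugE E t)
plugE (appL E s) t = app (plugE E t) s

plugF : ∀ {n} → FCtx n → Tm n → Tm n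
plugF □          t = t
plugF (appR v F) t = app (val v) (plugF F t)
plugF (appL F s) t = app (plugF F t) s
plugF (rst F)    t = rst (plugF F t)
plugF (cv α F)   t = cv α (plugF F t)

plugD : ∀ {n} → DCtx n → Tm n → Tm n
plugD (rst E)  t = rst (plugE E t)
plugD (cv α E) t = cv α (plugE E t)

embE : ∀ {n} → ECtx n → FCtx n
embE □          = □
embE (appR v E) = appR v (embE E)
embE (appL E s) = appL (embE E) s

embD : ∀ {n} → DCtx n → FCtx n
embD (rst E)  = rst (embE E)
embD (cv α E) = cv α (embE E)

_∘F_ : ∀ {n} → FCtx n → FCtx n → FCtx n
□          ∘F G = G
appR v F   ∘F G = appR v (F ∘F G)
appL F s   ∘F G = appL (F ∘F G) s
rst F      ∘F G = rst (F ∘F G)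
cv α F     ∘F G = cv α (F ∘F G)

renE : ∀ {n m} → Ren n m → ECtx n → ECtx m
renE ρ □          = □
renE ρ (appR v E) = appR (renV ρ v) (renE ρ E)
renE ρ (appL E s) = appL (renE ρ E) (renT ρ s)

renF : ∀ {n m} → Ren n m → FCtx n → FCtx m
renF ρ □          = □
renF ρ (appR v F) = appR (renV ρ v) (renF ρ F)
renF ρ (appL F s) = appL (renF ρ F) (renT ρ s)
renF ρ (rst F)    = rst (renF ρ F)
renF ρ (cv α F)   = cv α (renF ρ F)

renD : ∀ {n m} → Ren n m → DCtx n → DCtx m
renD ρ (rst E)  = rst (renE ρ E)
renD ρ (cv α E) = cv α (renE ρ E)

wkE : ∀ {n} → ECtx n → ECtx (suc n)
wkE = renE suc

wkF : ∀ {n} → FCtx n → FCtx (suc n)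
wkF = renF suc

wkD : ∀ {n} → DCtx n → DCtx (suc n)
wkD = renD suc

x₀ : ∀ {n} → Tm (suc n)
x₀ = val (var zero)

data _⟶_ {n : ℕ} : Tm n → Tm n → Set where
  βv    : ∀ (F : FCtx n) (t : Tm (suc n)) (v : Val n) →
          plugF F (app (val (lam t)) (val v)) ⟶ plugF F (t [ v ]₀)
  shift : ∀ (F : FCtx n) (D : DCtx n) (t : Tm (suc n)) →
          plugF F (plugD D (sft t))
            ⟶ plugF F (rst (t [ lam (plugD (wkD D) x₀) ]₀))
  reset : ∀ (F : FCtx n) (v : Val n) →
          plugF F (rst (val v)) ⟶ plugF F (val v)

_⟶*_ : ∀ {n} → Tm n → Tm n → Set
_⟶*_ = Star _⟶_

IsValue : ∀ {n} → Tm n → Set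
IsValue {n} t = ∃ λ (v : Val n) → t ≡ val v

OpenStuck : ∀ {n} → Tm n → Set
OpenStuck {n} t = Σ (FCtx n) λ F → Σ (Fin n) λ y → Σ (Val n) λ v →
  t ≡ plugF F (app (val (var y)) (val v))

ControlStuck : ∀ {n} → Tm n → Set
ControlStuck {n} t = Σ (ECtx n) λ E → Σ (Tm (suc n)) λ s → t ≡ plugE E (sft s)

ContextStuck : ∀ {n} → Tm n → Set
ContextStuck {n} t = Σ (FCtx n) λ F → Σ ℕ λ α → Σ (Val n) λ v →
  t ≡ plugF F (cv α (val v))

NF : ∀ {n} → Tm n → Set
NF t = IsValue t ⊎ OpenStuck t ⊎ ControlStuck t ⊎ ContextStuck t

_⇓_ : ∀ {n} → Tm n → Tm n → Set
t ⇓ t' = (t ⟶* t') × NF t'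

mutual
  PlainV : ∀ {n} → Val n → Set
  PlainV (var x) = ⊤
  PlainV (lam t) = Plain t

  Plain : ∀ {n} → Tm n → Set
  Plain (val v)   = PlainV v
  Plain (app s t) = Plain s × Plain t
  Plain (sft t)   = Plain t
  Plain (rst t)   = Plain t
  Plain (cv α t)  = ⊥

data Pure {n : ℕ} : Tm n → Set where
  val : ∀ v → Pure (val v)
  rst : ∀ t → Pure (rst t)
  cv  : ∀ α t → Pure (cv α t)

mutual
  FreshV : ∀ {n} → ℕ → Val n → Set
  FreshV α (var x) = ⊤
  FreshV α (lam t) = Fresh α t

  Fresh : ∀ {n} → ℕ → Tm n → Set
  Fresh α (val v)   = FreshV α v
  Fresh α (app s t) = Fresh α s × Fresh α t
  Fresh α (sft t)   = Fresh α t
  Fresh α (rst t)   = Fresh α t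
  Fresh α (cv β t)  = (α ≢ β) × Fresh α t

TRel : Set₁
TRel = ∀ {n} → Tm n → Tm n → Set

flipR : TRel → TRel
flipR R a b = R b a

ExtV : TRel → ∀ {n} → Val n → Val n → Set
ExtV R v₀ v₁ = ∀ α → FreshV α v₀ → FreshV α v₁ →
  R (cv α (app (val (wkV v₀)) x₀)) (cv α (app (val (wkV v₁)) x₀))

ExtC : TRel → ∀ {n} → FCtx n → FCtx n → Set
ExtC R {n} G₀ G₁ =
  Σ (FCtx n) λ F₀ → Σ (DCtx n) λ D₀ → Σ (FCtx n) λ F₁ → Σ (DCtx n) λ D₁ →
    (G₀ ≡ F₀ ∘F embD D₀) × (G₁ ≡ F₁ ∘F embD D₁) ×
    R (plugD (wkD D₀) x₀) (plugD (wkD D₁) x₀) ×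
    R (plugF (wkF F₀) x₀) (plugF (wkF F₁) x₀)

Progress : TRel → Set
Progress R = ∀ {n} {p₀ p₁ : Tm n} → R p₀ p₁ →
  (∀ {p₀'} → p₀ ⟶ p₀' → ∃ λ p₁' → (p₁ ⟶* p₁') × R p₀' p₁')
  × (∀ {v₀} → p₀ ≡ val v₀ → ∃ λ v₁ → (p₁ ⇓ val v₁) × ExtV R v₀ v₁)
  × (∀ {F₀ α v₀} → p₀ ≡ plugF F₀ (cv α (val v₀)) →
       Σ (FCtx n) λ F₁ → Σ (Val n) λ v₁ →
         (p₁ ⇓ plugF F₁ (cv α (val v₁)))
         × ExtC R (F₀ ∘F rst □) (F₁ ∘F rst □)
         × ExtV R v₀ v₁)
  × (∀ {F₀ y v₀} → p₀ ≡ plugF F₀ (app (val (var y)) (val v₀)) →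
       Σ (FCtx n) λ F₁ → Σ (Val n) λ v₁ →
         (p₁ ⇓ plugF F₁ (app (val (var y)) (val v₁)))
         × ExtC R F₀ F₁
         × ExtV R v₀ v₁)

IsPureNFBisim : TRel → Set
IsPureNFBisim R =
  (∀ {n} {p₀ p₁ : Tm n} → R p₀ p₁ → Pure p₀ × Pure p₁)
  × Progress R × Progress (flipR R)

_≈ₒᵖ_ : ∀ {n} → Tm n → Tm n → Set₁
p₀ ≈ₒᵖ p₁ = Σ TRel λ R → IsPureNFBisim R × R p₀ p₁

_≈ₒ_ : ∀ {n} → Tm n → Tm n → Set₁
t₀ ≈ₒ t₁ = ∀ α → Fresh α t₀ → Fresh α t₁ → cv α t₀ ≈ₒᵖ cv α t₁

-- Inside a delimiter α⟨·⟩, one shift step gives α⟨𝒮k.k t⟩ ⟶ ⟨κ t⟩ with κ = λx.α⟨x⟩.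
-- Relate α⟨s⟩ with ⟨κ s'⟩ whenever s and s' are related, and close under all term
-- constructors (the relation ∼). Both sides then reduce in lockstep: a shift
-- delimited by α⟨·⟩ on the left is matched by a shift delimited by ⟨κ ·⟩ on the right,
-- capturing related continuations. When s becomes a value v, the right side needs one
-- extra β-step to reach ⟨α⟨v⟩⟩, which is context-stuck like α⟨v⟩ but with one more
-- reset in its context; this is exactly what comparing F₀[⟨□⟩] with F₁[⟨□⟩] in the
-- context-stuck clause absorbs. As reduction is deterministic, "∼ after some reduction
-- of the right-hand side" is then a pure normal-form bisimulation.

module Submission where

open import Data.Nat using (ℕ; suc)
open import Data.Fin using (Fin; zero; suc)
open import Data.Product using (Σ; ∃; _×_; _,_)
open import Data.Sum using (_⊎_; inj₁; inj₂)
open import Data.Empty using (⊥-elim)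
open import Relation.Nullary using (¬_)
open import Relation.Binary.PropositionalEquality
open import Relation.Binary.Construct.Closure.ReflexiveTransitive using (ε; _◅_; _◅◅_; gmap)

open import Defs

private variable
  n : ℕ
  γ : ℕ
  y : Fin n
  s s' r t a b q q' p₀ p₁ p₀' : Tm n
  u : Tm (suc n)
  v w : Val n
  E E' : ECtx n
  F F₀ : FCtx n

plugF-∘F : (F G : FCtx n) (s : Tm n) → plugF (F ∘F G) s ≡ plugF F (plugF G s)
plugF-∘F □          G s = refl
plugF-∘F (appR v F) G s = cong (app (val v)) (plugF-∘F F G s)
plugF-∘F (appL F r) G s = cong (λ z → app z r) (plugF-∘F F G s)
plugF-∘F (rst F)    G s = cong rst (plugF-∘F F G s)
plugF-∘F (cv γ F)   G s = cong (cv γ) (plugF-∘F F G s)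

∘F-assoc : (F G H : FCtx n) → (F ∘F G) ∘F H ≡ F ∘F (G ∘F H)
∘F-assoc □          G H = refl
∘F-assoc (appR v F) G H = cong (appR v) (∘F-assoc F G H)
∘F-assoc (appL F r) G H = cong (λ K → appL K r) (∘F-assoc F G H)
∘F-assoc (rst F)    G H = cong rst (∘F-assoc F G H)
∘F-assoc (cv γ F)   G H = cong (cv γ) (∘F-assoc F G H)

renF-∘F : ∀ {m} (ρ : Ren n m) (F G : FCtx n) → renF ρ (F ∘F G) ≡ renF ρ F ∘F renF ρ G
renF-∘F ρ □          G = refl
renF-∘F ρ (appR v F) G = cong (appR (renV ρ v)) (renF-∘F ρ F G)
renF-∘F ρ (appL F r) G = cong (λ H → appL H (renT ρ r)) (renF-∘F ρ F G)
renF-∘F ρ (rst F)    G = cong rst (renF-∘F ρ F G)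
renF-∘F ρ (cv γ F)   G = cong (cv γ) (renF-∘F ρ F G)

exts-ext-id : ∀ {m} {σ : Sub m n} {ρ : Ren n m} → (∀ i → σ (ρ i) ≡ var i) →
              ∀ i → exts σ (ext ρ i) ≡ var i
exts-ext-id h zero    = refl
exts-ext-id h (suc i) = cong wkV (h i)

mutual
  subV-renV-id : ∀ {m} {σ : Sub m n} {ρ : Ren n m} → (∀ i → σ (ρ i) ≡ var i) →
                 ∀ v → subV σ (renV ρ v) ≡ v
  subV-renV-id h (var x) = h x
  subV-renV-id h (lam t) = cong lam (subT-renT-id (exts-ext-id h) t)

  subT-renT-id : ∀ {m} {σ : Sub m n} {ρ : Ren n m} → (∀ i → σ (ρ i) ≡ var i) →
                 ∀ t → subT σ (renT ρ t) ≡ t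
  subT-renT-id h (val v)   = cong val (subV-renV-id h v)
  subT-renT-id h (app s t) = cong₂ app (subT-renT-id h s) (subT-renT-id h t)
  subT-renT-id h (sft t)   = cong sft (subT-renT-id (exts-ext-id h) t)
  subT-renT-id h (rst t)   = cong rst (subT-renT-id h t)
  subT-renT-id h (cv γ t)  = cong (cv γ) (subT-renT-id h t)

wkT-[]₀ : (t : Tm n) (v : Val n) → wkT t [ v ]₀ ≡ t
wkT-[]₀ t v = subT-renT-id (λ i → refl) t

⟶-plugF : (G : FCtx n) → s ⟶ s' → plugF G s ⟶ plugF G s'
⟶-plugF G (βv F t v) =
  subst₂ _⟶_ (plugF-∘F G F _) (plugF-∘F G F _) (βv (G ∘F F) t v)
⟶-plugF G (shift F D t) =
  subst₂ _⟶_ (plugF-∘F G F _) (plugF-∘F G F _) (shift (G ∘F F) D t)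
⟶-plugF G (reset F v) =
  subst₂ _⟶_ (plugF-∘F G F _) (plugF-∘F G F _) (reset (G ∘F F) v)

⟶*-plugF : (G : FCtx n) → s ⟶* s' → plugF G s ⟶* plugF G s'
⟶*-plugF G = gmap (plugF G) (⟶-plugF G)

-- Syntax-directed reduction

data ControlStuckAt {n : ℕ} : Tm n → ECtx n → Tm (suc n) → Set where
  here : ControlStuckAt (sft u) □ u
  appL : ControlStuckAt s E u → ControlStuckAt (app s r) (appL E r) u
  appR : ControlStuckAt s E u → ControlStuckAt (app (val v) s) (appR v E) u

controlStuckAt-plugE : (E : ECtx n) (u : Tm (suc n)) → ControlStuckAt (plugE E (sft u)) E u
controlStuckAt-plugE □          u = here
controlStuckAt-plugE (appR v E) u = appR (controlStuckAt-plugE E u)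
controlStuckAt-plugE (appL E r) u = appL (controlStuckAt-plugE E u)

controlStuckAt⇒≡ : ControlStuckAt s E u → s ≡ plugE E (sft u)
controlStuckAt⇒≡ here     = refl
controlStuckAt⇒≡ (appL c) = cong (λ z → app z _) (controlStuckAt⇒≡ c)
controlStuckAt⇒≡ (appR c) = cong (app (val _)) (controlStuckAt⇒≡ c)

controlStuckAt-unique : ∀ {u'} → ControlStuckAt s E u → ControlStuckAt s E' u' → E ≡ E' × u ≡ u'
controlStuckAt-unique here     here      = refl , refl
controlStuckAt-unique (appL c) (appL c') with controlStuckAt-unique c c'
... | refl , refl = refl , refl
controlStuckAt-unique (appL ()) (appR c')
controlStuckAt-unique (appR c) (appL ())
controlStuckAt-unique (appR c) (appR c') with controlStuckAt-unique c c'
... | refl , refl = refl , refl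

infix 4 _↦_
data _↦_ {n : ℕ} : Tm n → Tm n → Set where
  β         : app (val (lam u)) (val v) ↦ u [ v ]₀
  reset     : rst (val v) ↦ val v
  shift-rst : ControlStuckAt s E u → rst s ↦ rst (u [ lam (plugD (wkD (rst E)) x₀) ]₀)
  shift-cv  : ControlStuckAt s E u → cv γ s ↦ rst (u [ lam (plugD (wkD (cv γ E)) x₀) ]₀)
  appL      : s ↦ s' → app s r ↦ app s' r
  appR      : s ↦ s' → app (val v) s ↦ app (val v) s'
  rst       : s ↦ s' → rst s ↦ rst s'
  cv        : s ↦ s' → cv γ s ↦ cv γ s'

↦-plugF : (F : FCtx n) → s ↦ s' → plugF F s ↦ plugF F s'
↦-plugF □          st = st
↦-plugF (appR v F) st = appR (↦-plugF F st)
↦-plugF (appL F r) st = appL (↦-plugF F st)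
↦-plugF (rst F)    st = rst (↦-plugF F st)
↦-plugF (cv γ F)   st = cv (↦-plugF F st)

⟶⇒↦ : s ⟶ s' → s ↦ s'
⟶⇒↦ (βv F t v)           = ↦-plugF F β
⟶⇒↦ (shift F (rst E) t)  = ↦-plugF F (shift-rst (controlStuckAt-plugE E t))
⟶⇒↦ (shift F (cv γ E) t) = ↦-plugF F (shift-cv (controlStuckAt-plugE E t))
⟶⇒↦ (reset F v)          = ↦-plugF F reset

↦⇒⟶ : s ↦ s' → s ⟶ s'
↦⇒⟶ (β {u = u} {v = v}) = βv □ u v
↦⇒⟶ (reset {v = v})     = reset □ v
↦⇒⟶ (shift-rst {E = E} {u = u} c)
  rewrite controlStuckAt⇒≡ c = shift □ (rst E) u
↦⇒⟶ (shift-cv {E = E} {u = u} {γ = γ} c)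
  rewrite controlStuckAt⇒≡ c = shift □ (cv γ E) u
↦⇒⟶ (appL st) = ⟶-plugF (appL □ _) (↦⇒⟶ st)
↦⇒⟶ (appR st) = ⟶-plugF (appR _ □) (↦⇒⟶ st)
↦⇒⟶ (rst st)  = ⟶-plugF (rst □) (↦⇒⟶ st)
↦⇒⟶ (cv st)   = ⟶-plugF (cv _ □) (↦⇒⟶ st)

↦⇒⟶* : s ↦ s' → s ⟶* s'
↦⇒⟶* st = ↦⇒⟶ st ◅ ε

Irreducible : Tm n → Set
Irreducible s = ∀ {s'} → ¬ (s ↦ s')

controlStuckAt-irreducible : ControlStuckAt s E u → Irreducible s
controlStuckAt-irreducible here     ()
controlStuckAt-irreducible (appL c) (appL st) = controlStuckAt-irreducible c st
controlStuckAt-irreducible (appL ()) β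
controlStuckAt-irreducible (appL ()) (appR st)
controlStuckAt-irreducible (appR ()) β
controlStuckAt-irreducible (appR c) (appL ())
controlStuckAt-irreducible (appR c) (appR st) = controlStuckAt-irreducible c st

↦-deterministic : s ↦ a → s ↦ b → a ≡ b
↦-deterministic β            β             = refl
↦-deterministic β            (appL ())
↦-deterministic β            (appR ())
↦-deterministic reset        reset         = refl
↦-deterministic reset        (shift-rst ())
↦-deterministic reset        (rst ())
↦-deterministic (shift-rst ()) reset
↦-deterministic (shift-rst c) (shift-rst c') with controlStuckAt-unique c c'
... | refl , refl = refl
↦-deterministic (shift-rst c) (rst st)     = ⊥-elim (controlStuckAt-irreducible c st)
↦-deterministic (shift-cv c) (shift-cv c') with controlStuckAt-unique c c'
... | refl , refl = refl
↦-deterministic (shift-cv c) (cv st)       = ⊥-elim (controlStuckAt-irreducible c st)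
↦-deterministic (appL ())    β
↦-deterministic (appL st)    (appL st')    = cong (λ z → app z _) (↦-deterministic st st')
↦-deterministic (appL ())    (appR st')
↦-deterministic (appR ())    β
↦-deterministic (appR st)    (appL ())
↦-deterministic (appR st)    (appR st')    = cong (app (val _)) (↦-deterministic st st')
↦-deterministic (rst ())     reset
↦-deterministic (rst st)     (shift-rst c) = ⊥-elim (controlStuckAt-irreducible c st)
↦-deterministic (rst st)     (rst st')     = cong rst (↦-deterministic st st')
↦-deterministic (cv st)      (shift-cv c)  = ⊥-elim (controlStuckAt-irreducible c st)
↦-deterministic (cv st)      (cv st')      = cong (cv _) (↦-deterministic st st')

irreducible-⟶* : Irreducible s → s ⟶* q → s ≡ q
irreducible-⟶* irr ε        = refl
irreducible-⟶* irr (st ◅ _) = ⊥-elim (irr (⟶⇒↦ st))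

pure-↦ : Pure s → s ↦ s' → Pure s'
pure-↦ (rst _)  reset         = val _
pure-↦ (rst _)  (shift-rst c) = rst _
pure-↦ (rst _)  (rst st)      = rst _
pure-↦ (cv _ _) (shift-cv c)  = rst _
pure-↦ (cv _ _) (cv st)       = cv _ _

pure-⟶* : Pure s → s ⟶* s' → Pure s'
pure-⟶* p ε          = p
pure-⟶* p (st ◅ sts) = pure-⟶* (pure-↦ p (⟶⇒↦ st)) sts

-- Irreducibility of stuck terms

data Plugged {n : ℕ} : Tm n → FCtx n → Tm n → Set where
  here : Plugged a □ a
  appR : Plugged s F a → Plugged (app (val w) s) (appR w F) a
  appL : Plugged s F a → Plugged (app s r) (appL F r) a
  rst  : Plugged s F a → Plugged (rst s) (rst F) a
  cv   : Plugged s F a → Plugged (cv γ s) (cv γ F) a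

plugged-plugF : (F : FCtx n) (a : Tm n) → Plugged (plugF F a) F a
plugged-plugF □          a = here
plugged-plugF (appR w F) a = appR (plugged-plugF F a)
plugged-plugF (appL F r) a = appL (plugged-plugF F a)
plugged-plugF (rst F)    a = rst (plugged-plugF F a)
plugged-plugF (cv γ F)   a = cv (plugged-plugF F a)

plugged-val : Plugged (val v) F a → IsValue a
plugged-val here = _ , refl

plugged-¬controlStuckAt : Plugged s F a → ¬ IsValue a → (∀ {E u} → ¬ ControlStuckAt a E u) →
                          ¬ ControlStuckAt s E u
plugged-¬controlStuckAt here     nv nc c        = nc c
plugged-¬controlStuckAt (appR P) nv nc (appR c) = plugged-¬controlStuckAt P nv nc c
plugged-¬controlStuckAt (appL P) nv nc (appL c) = plugged-¬controlStuckAt P nv nc c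
plugged-¬controlStuckAt (appL P) nv nc (appR c) = nv (plugged-val P)

plugged-irreducible : Plugged s F a → ¬ IsValue a → Irreducible a →
                      (∀ {E u} → ¬ ControlStuckAt a E u) → Irreducible s
plugged-irreducible here     nv irr nc st            = irr st
plugged-irreducible (appR P) nv irr nc β             = nv (plugged-val P)
plugged-irreducible (appR P) nv irr nc (appR st)     = plugged-irreducible P nv irr nc st
plugged-irreducible (appL P) nv irr nc β             = nv (plugged-val P)
plugged-irreducible (appL P) nv irr nc (appL st)     = plugged-irreducible P nv irr nc st
plugged-irreducible (appL P) nv irr nc (appR st)     = nv (plugged-val P)
plugged-irreducible (rst P)  nv irr nc reset         = nv (plugged-val P)
plugged-irreducible (rst P)  nv irr nc (shift-rst c) = plugged-¬controlStuckAt P nv nc c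
plugged-irreducible (rst P)  nv irr nc (rst st)      = plugged-irreducible P nv irr nc st
plugged-irreducible (cv P)   nv irr nc (shift-cv c)  = plugged-¬controlStuckAt P nv nc c
plugged-irreducible (cv P)   nv irr nc (cv st)       = plugged-irreducible P nv irr nc st

openStuck-irreducible : (F : FCtx n) → Irreducible (plugF F (app (val (var y)) (val v)))
openStuck-irreducible F =
  plugged-irreducible (plugged-plugF F _) (λ { (_ , ()) })
    (λ { (appL ()) ; (appR ()) }) (λ { (appR ()) })

contextStuck-irreducible : (F : FCtx n) → Irreducible (plugF F (cv γ (val v)))
contextStuck-irreducible F =
  plugged-irreducible (plugged-plugF F _) (λ { (_ , ()) })
    (λ { (shift-cv ()) ; (cv ()) }) (λ ())

data PureCtx {n : ℕ} : FCtx n → Set where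
  □   : PureCtx □
  rst : PureCtx (rst F)
  cv  : PureCtx (cv γ F)

pureCtx-plugF : PureCtx F → Pure a → Pure (plugF F a)
pureCtx-plugF □   p = p
pureCtx-plugF rst p = rst _
pureCtx-plugF cv  p = cv _ _

plugF-pure⇒pureCtx : (F : FCtx n) → Pure (plugF F a) → PureCtx F
plugF-pure⇒pureCtx □          p = □
plugF-pure⇒pureCtx (appR v F) ()
plugF-pure⇒pureCtx (appL F r) ()
plugF-pure⇒pureCtx (rst F)    p = rst
plugF-pure⇒pureCtx (cv γ F)   p = cv

pureCtx-∘F⁻ : (F G : FCtx n) → PureCtx (F ∘F G) → PureCtx F
pureCtx-∘F⁻ □        G p = □
pureCtx-∘F⁻ (rst F)  G p = rst
pureCtx-∘F⁻ (cv γ F) G p = cv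

pureCtx-renF : ∀ {m} (ρ : Ren n m) → PureCtx F → PureCtx (renF ρ F)
pureCtx-renF ρ □   = □
pureCtx-renF ρ rst = rst
pureCtx-renF ρ cv  = cv

pureCtx-∘rst : PureCtx F → PureCtx (F ∘F rst □)
pureCtx-∘rst □   = rst
pureCtx-∘rst rst = rst
pureCtx-∘rst cv  = cv

pure-plugD : (D : DCtx n) (a : Tm n) → Pure (plugD D a)
pure-plugD (rst E)  a = rst _
pure-plugD (cv γ E) a = cv _ _

¬pure-plugE-app : (E : ECtx n) → ¬ Pure (plugF (embE E) (app a b))
¬pure-plugE-app □          ()
¬pure-plugE-app (appR v E) ()
¬pure-plugE-app (appL E r) ()

openStuck-NF : NF (plugF F (app (val (var y)) (val v)))
openStuck-NF = inj₂ (inj₁ (_ , _ , _ , refl))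

contextStuck-NF : NF (plugF F (cv γ (val v)))
contextStuck-NF = inj₂ (inj₂ (inj₂ (_ , _ , _ , refl)))

ExtC-flip : {R : TRel} {G₀ G₁ : FCtx n} → ExtC R G₀ G₁ → ExtC (flipR R) G₁ G₀
ExtC-flip (F₀ , D₀ , F₁ , D₁ , eq₀ , eq₁ , rD , rF) = F₁ , D₁ , F₀ , D₀ , eq₁ , eq₀ , rD , rF

ExtC-∘F-rst : {R : TRel} {F₁ : FCtx n} → R (rst (x₀ {n})) (rst x₀) →
              R (plugF (wkF F₀) x₀) (plugF (wkF F₁) x₀) → ExtC R (F₀ ∘F rst □) (F₁ ∘F rst □)
ExtC-∘F-rst rD rF = _ , rst □ , _ , rst □ , refl , refl , rD , rF

wkF-∘F-rst-⟶* : (F : FCtx n) → plugF (wkF (F ∘F rst □)) x₀ ⟶* plugF (wkF F) x₀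
wkF-∘F-rst-⟶* F rewrite renF-∘F suc F (rst □) | plugF-∘F (wkF F) (rst □) x₀ =
  reset (wkF F) (var zero) ◅ ε

-- The bisimulation

module Bisimulation (α : ℕ) where

  κ : Val n
  κ = lam (cv α x₀)

  κ⟨_⟩ : Tm n → Tm n
  κ⟨ s ⟩ = rst (app (val κ) s)

  infix 4 _∼V_ _∼_ _∼E_ _∼F_ _∼D_ _∼F⁺_

  mutual
    data _∼V_ {n : ℕ} : Val n → Val n → Set where
      ~var : (x : Fin n) → var x ∼V var x
      ~lam : {s s' : Tm (suc n)} → s ∼ s' → lam s ∼V lam s'

    data _∼_ {n : ℕ} : Tm n → Tm n → Set where
      ~val  : v ∼V w → val v ∼ val w
      ~app  : s ∼ s' → r ∼ t → app s r ∼ app s' t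
      ~sft  : {s s' : Tm (suc n)} → s ∼ s' → sft s ∼ sft s'
      ~rst  : s ∼ s' → rst s ∼ rst s'
      ~cv   : (γ : ℕ) → s ∼ s' → cv γ s ∼ cv γ s'
      α∼κ   : s ∼ s' → cv α s ∼ κ⟨ s' ⟩
      -- ⟨α⟨w⟩⟩ is κ⟨ val w ⟩ after a β-step that the left side does not mirror
      α∼⟨α⟩ : v ∼V w → cv α (val v) ∼ rst (cv α (val w))

  mutual
    ∼V-refl : (v : Val n) → v ∼V v
    ∼V-refl (var x) = ~var x
    ∼V-refl (lam t) = ~lam (∼-refl t)

    ∼-refl : (t : Tm n) → t ∼ t
    ∼-refl (val v)   = ~val (∼V-refl v)
    ∼-refl (app s t) = ~app (∼-refl s) (∼-refl t)
    ∼-refl (sft t)   = ~sft (∼-refl t)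
    ∼-refl (rst t)   = ~rst (∼-refl t)
    ∼-refl (cv γ t)  = ~cv γ (∼-refl t)

  mutual
    ∼V-renV : ∀ {m} (ρ : Ren n m) → v ∼V w → renV ρ v ∼V renV ρ w
    ∼V-renV ρ (~var x) = ~var (ρ x)
    ∼V-renV ρ (~lam r) = ~lam (∼-renT (ext ρ) r)

    ∼-renT : ∀ {m} (ρ : Ren n m) → s ∼ s' → renT ρ s ∼ renT ρ s'
    ∼-renT ρ (~val r)    = ~val (∼V-renV ρ r)
    ∼-renT ρ (~app r r') = ~app (∼-renT ρ r) (∼-renT ρ r')
    ∼-renT ρ (~sft r)    = ~sft (∼-renT (ext ρ) r)
    ∼-renT ρ (~rst r)    = ~rst (∼-renT ρ r)
    ∼-renT ρ (~cv γ r)   = ~cv γ (∼-renT ρ r)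
    ∼-renT ρ (α∼κ r)     = α∼κ (∼-renT ρ r)
    ∼-renT ρ (α∼⟨α⟩ r)   = α∼⟨α⟩ (∼V-renV ρ r)

  _∼Sub_ : ∀ {m} → Sub n m → Sub n m → Set
  σ ∼Sub σ' = ∀ i → σ i ∼V σ' i

  ∼Sub-exts : ∀ {m} {σ σ' : Sub n m} → σ ∼Sub σ' → exts σ ∼Sub exts σ'
  ∼Sub-exts h zero    = ~var zero
  ∼Sub-exts h (suc i) = ∼V-renV suc (h i)

  mutual
    ∼V-subV : ∀ {m} {σ σ' : Sub n m} → σ ∼Sub σ' → v ∼V w → subV σ v ∼V subV σ' w
    ∼V-subV h (~var x) = h x
    ∼V-subV h (~lam r) = ~lam (∼-subT (∼Sub-exts h) r)

    ∼-subT : ∀ {m} {σ σ' : Sub n m} → σ ∼Sub σ' → s ∼ s' → subT σ s ∼ subT σ' s'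
    ∼-subT h (~val r)    = ~val (∼V-subV h r)
    ∼-subT h (~app r r') = ~app (∼-subT h r) (∼-subT h r')
    ∼-subT h (~sft r)    = ~sft (∼-subT (∼Sub-exts h) r)
    ∼-subT h (~rst r)    = ~rst (∼-subT h r)
    ∼-subT h (~cv γ r)   = ~cv γ (∼-subT h r)
    ∼-subT h (α∼κ r)     = α∼κ (∼-subT h r)
    ∼-subT h (α∼⟨α⟩ r)   = α∼⟨α⟩ (∼V-subV h r)

  ∼-[]₀ : {u u' : Tm (suc n)} → u ∼ u' → v ∼V w → u [ v ]₀ ∼ u' [ w ]₀
  ∼-[]₀ {v = v} {w = w} r rv = ∼-subT sub0-∼ r
    where
    sub0-∼ : sub0 v ∼Sub sub0 w
    sub0-∼ zero    = rv
    sub0-∼ (suc i) = ~var i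

  ∼-pure : Pure s → s ∼ s' → Pure s'
  ∼-pure (val _)  (~val r)    = val _
  ∼-pure (rst _)  (~rst r)    = rst _
  ∼-pure (cv _ _) (~cv γ r)   = cv _ _
  ∼-pure (cv _ _) (α∼κ r)     = rst _
  ∼-pure (cv _ _) (α∼⟨α⟩ r)   = rst _

  data _∼E_ {n : ℕ} : ECtx n → ECtx n → Set where
    □    : □ ∼E □
    appR : v ∼V w → E ∼E E' → appR v E ∼E appR w E'
    appL : E ∼E E' → r ∼ t → appL E r ∼E appL E' t

  data _∼F_ {n : ℕ} : FCtx n → FCtx n → Set where
    □    : □ ∼F □
    appR : ∀ {F F'} → v ∼V w → F ∼F F' → appR v F ∼F appR w F'
    appL : ∀ {F F'} → F ∼F F' → r ∼ t → appL F r ∼F appL F' t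
    rst  : ∀ {F F'} → F ∼F F' → rst F ∼F rst F'
    cv   : ∀ γ {F F'} → F ∼F F' → cv γ F ∼F cv γ F'
    α∼κ  : ∀ {F F'} → F ∼F F' → cv α F ∼F rst (appR κ F')

  data _∼D_ {n : ℕ} : DCtx n → DCtx n → Set where
    rst : E ∼E E' → rst E ∼D rst E'
    cv  : ∀ γ → E ∼E E' → cv γ E ∼D cv γ E'
    α∼κ : E ∼E E' → cv α E ∼D rst (appR κ E')

  ∼-plugE : E ∼E E' → s ∼ s' → plugE E s ∼ plugE E' s'
  ∼-plugE □           r = r
  ∼-plugE (appR rv e) r = ~app (~val rv) (∼-plugE e r)
  ∼-plugE (appL e rt) r = ~app (∼-plugE e r) rt

  ∼-plugF : ∀ {F F'} → F ∼F F' → s ∼ s' → plugF F s ∼ plugF F' s'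
  ∼-plugF □           r = r
  ∼-plugF (appR rv e) r = ~app (~val rv) (∼-plugF e r)
  ∼-plugF (appL e rt) r = ~app (∼-plugF e r) rt
  ∼-plugF (rst e)     r = ~rst (∼-plugF e r)
  ∼-plugF (cv γ e)    r = ~cv γ (∼-plugF e r)
  ∼-plugF (α∼κ e)     r = α∼κ (∼-plugF e r)

  ∼-plugD : ∀ {D D'} → D ∼D D' → s ∼ s' → plugD D s ∼ plugD D' s'
  ∼-plugD (rst e)  r = ~rst (∼-plugE e r)
  ∼-plugD (cv γ e) r = ~cv γ (∼-plugE e r)
  ∼-plugD (α∼κ e)  r = α∼κ (∼-plugE e r)

  ∼E-renE : ∀ {m} (ρ : Ren n m) → E ∼E E' → renE ρ E ∼E renE ρ E'
  ∼E-renE ρ □           = □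
  ∼E-renE ρ (appR rv e) = appR (∼V-renV ρ rv) (∼E-renE ρ e)
  ∼E-renE ρ (appL e rt) = appL (∼E-renE ρ e) (∼-renT ρ rt)

  ∼F-renF : ∀ {m} (ρ : Ren n m) {F F'} → F ∼F F' → renF ρ F ∼F renF ρ F'
  ∼F-renF ρ □           = □
  ∼F-renF ρ (appR rv e) = appR (∼V-renV ρ rv) (∼F-renF ρ e)
  ∼F-renF ρ (appL e rt) = appL (∼F-renF ρ e) (∼-renT ρ rt)
  ∼F-renF ρ (rst e)     = rst (∼F-renF ρ e)
  ∼F-renF ρ (cv γ e)    = cv γ (∼F-renF ρ e)
  ∼F-renF ρ (α∼κ e)     = α∼κ (∼F-renF ρ e)

  ∼D-renD : ∀ {m} (ρ : Ren n m) {D D'} → D ∼D D' → renD ρ D ∼D renD ρ D'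
  ∼D-renD ρ (rst e)  = rst (∼E-renE ρ e)
  ∼D-renD ρ (cv γ e) = cv γ (∼E-renE ρ e)
  ∼D-renD ρ (α∼κ e)  = α∼κ (∼E-renE ρ e)

  ∼-x₀ : x₀ {n} ∼ x₀
  ∼-x₀ = ~val (~var zero)

  ∼-plugF-x₀ : ∀ {F F' : FCtx n} → F ∼F F' → plugF (wkF F) x₀ ∼ plugF (wkF F') x₀
  ∼-plugF-x₀ e = ∼-plugF (∼F-renF suc e) ∼-x₀

  ∼-plugD-x₀ : ∀ {D D' : DCtx n} → D ∼D D' → plugD (wkD D) x₀ ∼ plugD (wkD D') x₀
  ∼-plugD-x₀ d = ∼-plugD (∼D-renD suc d) ∼-x₀

  ∼-shifted : ∀ {D D' : DCtx n} {u u' : Tm (suc n)} → D ∼D D' → u ∼ u' →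
              rst (u [ lam (plugD (wkD D) x₀) ]₀) ∼ rst (u' [ lam (plugD (wkD D') x₀) ]₀)
  ∼-shifted d r = ~rst (∼-[]₀ r (~lam (∼-plugD-x₀ d)))

  controlStuckAt-→ : ∀ {u} → ControlStuckAt s E u → s ∼ q →
                     Σ (ECtx _) λ E' → Σ (Tm _) λ u' → ControlStuckAt q E' u' × E ∼E E' × u ∼ u'
  controlStuckAt-→ here     (~sft r)      = _ , _ , here , □ , r
  controlStuckAt-→ (appL c) (~app r rt) with controlStuckAt-→ c r
  ... | _ , _ , c' , e , ru = _ , _ , appL c' , appL e rt , ru
  controlStuckAt-→ (appR c) (~app (~val rv) r) with controlStuckAt-→ c r
  ... | _ , _ , c' , e , ru = _ , _ , appR c' , appR rv e , ru

  controlStuckAt-← : ∀ {u'} → ControlStuckAt q E' u' → s ∼ q →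
                     Σ (ECtx _) λ E → Σ (Tm _) λ u → ControlStuckAt s E u × E ∼E E' × u ∼ u'
  controlStuckAt-← here     (~sft r)      = _ , _ , here , □ , r
  controlStuckAt-← (appL c) (~app r rt) with controlStuckAt-← c r
  ... | _ , _ , c' , e , ru = _ , _ , appL c' , appL e rt , ru
  controlStuckAt-← (appR c) (~app (~val rv) r) with controlStuckAt-← c r
  ... | _ , _ , c' , e , ru = _ , _ , appR c' , appR rv e , ru

  step-→ : s ∼ q → s ↦ s' → ∃ λ q' → q ⟶* q' × s' ∼ q'
  step-→ (~app (~val (~lam r)) (~val rv)) β = _ , ↦⇒⟶* β , ∼-[]₀ r rv
  step-→ (~rst (~val rv)) reset = _ , ↦⇒⟶* reset , ~val rv
  step-→ (~rst r) (shift-rst c) with controlStuckAt-→ c r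
  ... | _ , _ , c' , e , ru = _ , ↦⇒⟶* (shift-rst c') , ∼-shifted (rst e) ru
  step-→ (~cv γ r) (shift-cv c) with controlStuckAt-→ c r
  ... | _ , _ , c' , e , ru = _ , ↦⇒⟶* (shift-cv c') , ∼-shifted (cv γ e) ru
  step-→ (α∼κ r) (shift-cv c) with controlStuckAt-→ c r
  ... | _ , _ , c' , e , ru = _ , ↦⇒⟶* (shift-rst (appR c')) , ∼-shifted (α∼κ e) ru
  step-→ (~app r rt) (appL st) with step-→ r st
  ... | _ , sts , r' = _ , ⟶*-plugF (appL □ _) sts , ~app r' rt
  step-→ (~app (~val rv) r) (appR st) with step-→ r st
  ... | _ , sts , r' = _ , ⟶*-plugF (appR _ □) sts , ~app (~val rv) r'
  step-→ (~rst r) (rst st) with step-→ r st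
  ... | _ , sts , r' = _ , ⟶*-plugF (rst □) sts , ~rst r'
  step-→ (~cv γ r) (cv st) with step-→ r st
  ... | _ , sts , r' = _ , ⟶*-plugF (cv γ □) sts , ~cv γ r'
  step-→ (α∼κ r) (cv st) with step-→ r st
  ... | _ , sts , r' = _ , ⟶*-plugF (rst (appR κ □)) sts , α∼κ r'

  step-← : s ∼ q → q ↦ q' → ∃ λ s' → s ⟶* s' × s' ∼ q'
  step-← (~app (~val (~lam r)) (~val rv)) β = _ , ↦⇒⟶* β , ∼-[]₀ r rv
  step-← (~rst (~val rv)) reset = _ , ↦⇒⟶* reset , ~val rv
  step-← (~rst r) (shift-rst c) with controlStuckAt-← c r
  ... | _ , _ , c' , e , ru = _ , ↦⇒⟶* (shift-rst c') , ∼-shifted (rst e) ru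
  step-← (~cv γ r) (shift-cv c) with controlStuckAt-← c r
  ... | _ , _ , c' , e , ru = _ , ↦⇒⟶* (shift-cv c') , ∼-shifted (cv γ e) ru
  step-← (α∼κ r) (shift-rst (appR c)) with controlStuckAt-← c r
  ... | _ , _ , c' , e , ru = _ , ↦⇒⟶* (shift-cv c') , ∼-shifted (α∼κ e) ru
  step-← (α∼κ (~val rv)) (rst β) = _ , ε , α∼⟨α⟩ rv
  step-← (~app r rt) (appL st) with step-← r st
  ... | _ , sts , r' = _ , ⟶*-plugF (appL □ _) sts , ~app r' rt
  step-← (~app (~val rv) r) (appR st) with step-← r st
  ... | _ , sts , r' = _ , ⟶*-plugF (appR _ □) sts , ~app (~val rv) r'
  step-← (~rst r) (rst st) with step-← r st
  ... | _ , sts , r' = _ , ⟶*-plugF (rst □) sts , ~rst r'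
  step-← (~cv γ r) (cv st) with step-← r st
  ... | _ , sts , r' = _ , ⟶*-plugF (cv γ □) sts , ~cv γ r'
  step-← (α∼κ r) (rst (appR st)) with step-← r st
  ... | _ , sts , r' = _ , ⟶*-plugF (cv α □) sts , α∼κ r'

  ContextStuckImage : ℕ → Val n → FCtx n → Tm n → Set
  ContextStuckImage γ w F' q =
    q ≡ plugF F' (cv γ (val w)) ⊎ (γ ≡ α × q ⟶* plugF F' (rst (cv α (val w))))

  contextStuckImage-plugF : ∀ {F'} (G : FCtx n) → ContextStuckImage γ w F' q →
                            ContextStuckImage γ w (G ∘F F') (plugF G q)
  contextStuckImage-plugF {F' = F'} G (inj₁ eq) =
    inj₁ (trans (cong (plugF G) eq) (sym (plugF-∘F G F' _)))
  contextStuckImage-plugF {F' = F'} G (inj₂ (refl , sts)) =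
    inj₂ (refl , subst (_ ⟶*_) (sym (plugF-∘F G F' _)) (⟶*-plugF G sts))

  contextStuck-→ : Plugged s F (cv γ (val v)) → s ∼ q →
                   Σ (FCtx _) λ F' → Σ (Val _) λ w → v ∼V w × F ∼F F' × ContextStuckImage γ w F' q
  contextStuck-→ here (~cv γ (~val rv)) = _ , _ , rv , □ , inj₁ refl
  contextStuck-→ here (α∼κ (~val rv))   = _ , _ , rv , □ , inj₂ (refl , ↦⇒⟶* (rst β))
  contextStuck-→ here (α∼⟨α⟩ rv)        = _ , _ , rv , □ , inj₂ (refl , ε)
  contextStuck-→ (appR P) (~app (~val rw) r) with contextStuck-→ P r
  ... | _ , _ , rv , e , img = _ , _ , rv , appR rw e , contextStuckImage-plugF (appR _ □) img
  contextStuck-→ (appL P) (~app r rt) with contextStuck-→ P r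
  ... | _ , _ , rv , e , img = _ , _ , rv , appL e rt , contextStuckImage-plugF (appL □ _) img
  contextStuck-→ (rst P) (~rst r) with contextStuck-→ P r
  ... | _ , _ , rv , e , img = _ , _ , rv , rst e , contextStuckImage-plugF (rst □) img
  contextStuck-→ (cv P) (~cv γ r) with contextStuck-→ P r
  ... | _ , _ , rv , e , img = _ , _ , rv , cv γ e , contextStuckImage-plugF (cv γ □) img
  contextStuck-→ (cv P) (α∼κ r) with contextStuck-→ P r
  ... | _ , _ , rv , e , img = _ , _ , rv , α∼κ e , contextStuckImage-plugF (rst (appR κ □)) img

  openStuck-→ : Plugged s F (app (val (var y)) (val v)) → s ∼ q →
                Σ (FCtx _) λ F' → Σ (Val _) λ w →
                  v ∼V w × F ∼F F' × q ≡ plugF F' (app (val (var y)) (val w))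
  openStuck-→ here (~app (~val (~var y)) (~val rv)) = _ , _ , rv , □ , refl
  openStuck-→ (appR P) (~app (~val rw) r) with openStuck-→ P r
  ... | _ , _ , rv , e , eq = _ , _ , rv , appR rw e , cong (plugF (appR _ □)) eq
  openStuck-→ (appL P) (~app r rt) with openStuck-→ P r
  ... | _ , _ , rv , e , eq = _ , _ , rv , appL e rt , cong (plugF (appL □ _)) eq
  openStuck-→ (rst P) (~rst r) with openStuck-→ P r
  ... | _ , _ , rv , e , eq = _ , _ , rv , rst e , cong rst eq
  openStuck-→ (cv P) (~cv γ r) with openStuck-→ P r
  ... | _ , _ , rv , e , eq = _ , _ , rv , cv γ e , cong (cv γ) eq
  openStuck-→ (cv P) (α∼κ r) with openStuck-→ P r
  ... | _ , _ , rv , e , eq = _ , _ , rv , α∼κ e , cong κ⟨_⟩ eq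

  data _∼F⁺_ {n : ℕ} : FCtx n → FCtx n → Set where
    exact     : ∀ {F F'} → F ∼F F' → F ∼F⁺ F'
    extra-rst : ∀ {F F'} → F ∼F F' → F ∼F⁺ (F' ∘F rst □)

  ∼F⁺-frame : ∀ {F F'} (H H' : FCtx n) → (∀ {G G'} → G ∼F G' → H ∘F G ∼F H' ∘F G') →
              F ∼F⁺ F' → H ∘F F ∼F⁺ H' ∘F F'
  ∼F⁺-frame H H' frame (exact e) = exact (frame e)
  ∼F⁺-frame H H' frame (extra-rst {F' = F'} e) =
    subst (H ∘F _ ∼F⁺_) (∘F-assoc H' F' (rst □)) (extra-rst (frame e))

  contextStuck-← : ∀ {F'} → Plugged q F' (cv γ (val w)) → s ∼ q →
                   Σ (FCtx _) λ F → Σ (Val _) λ v →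
                     s ≡ plugF F (cv γ (val v)) × v ∼V w × F ∼F⁺ F'
  contextStuck-← here (~cv γ (~val rv)) = □ , _ , refl , rv , exact □
  contextStuck-← (rst here) (α∼⟨α⟩ rv) = □ , _ , refl , rv , extra-rst □
  contextStuck-← (appR P) (~app (~val rw) r) with contextStuck-← P r
  ... | _ , _ , eq , rv , e =
    _ , _ , cong (plugF (appR _ □)) eq , rv , ∼F⁺-frame (appR _ □) (appR _ □) (appR rw) e
  contextStuck-← (appL P) (~app r rt) with contextStuck-← P r
  ... | _ , _ , eq , rv , e =
    _ , _ , cong (plugF (appL □ _)) eq , rv , ∼F⁺-frame (appL □ _) (appL □ _) (λ g → appL g rt) e
  contextStuck-← (rst P) (~rst r) with contextStuck-← P r
  ... | _ , _ , eq , rv , e =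
    _ , _ , cong rst eq , rv , ∼F⁺-frame (rst □) (rst □) rst e
  contextStuck-← (rst (appR P)) (α∼κ r) with contextStuck-← P r
  ... | _ , _ , eq , rv , e =
    _ , _ , cong (cv α) eq , rv , ∼F⁺-frame (cv α □) (rst (appR κ □)) α∼κ e
  contextStuck-← (cv P) (~cv γ r) with contextStuck-← P r
  ... | _ , _ , eq , rv , e =
    _ , _ , cong (cv γ) eq , rv , ∼F⁺-frame (cv γ □) (cv γ □) (cv γ) e

  openStuck-← : ∀ {F'} → Plugged q F' (app (val (var y)) (val w)) → s ∼ q →
                Σ (FCtx _) λ F → Σ (Val _) λ v →
                  s ≡ plugF F (app (val (var y)) (val v)) × v ∼V w × F ∼F F'
  openStuck-← here (~app (~val (~var y)) (~val rv)) = □ , _ , refl , rv , □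
  openStuck-← (appR P) (~app (~val rw) r) with openStuck-← P r
  ... | _ , _ , eq , rv , e = _ , _ , cong (plugF (appR _ □)) eq , rv , appR rw e
  openStuck-← (appL P) (~app r rt) with openStuck-← P r
  ... | _ , _ , eq , rv , e = _ , _ , cong (plugF (appL □ _)) eq , rv , appL e rt
  openStuck-← (rst P) (~rst r) with openStuck-← P r
  ... | _ , _ , eq , rv , e = _ , _ , cong rst eq , rv , rst e
  openStuck-← (rst (appR P)) (α∼κ r) with openStuck-← P r
  ... | _ , _ , eq , rv , e = _ , _ , cong (cv α) eq , rv , α∼κ e
  openStuck-← (rst (appL ())) (α∼κ r)
  openStuck-← (rst (cv ())) (α∼⟨α⟩ rv)
  openStuck-← (cv P) (~cv γ r) with openStuck-← P r
  ... | _ , _ , eq , rv , e = _ , _ , cong (cv γ) eq , rv , cv γ e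

  data ∼F-Split {n : ℕ} : FCtx n → FCtx n → Set where
    pure  : E ∼E E' → ∼F-Split (embE E) (embE E')
    delim : ∀ {F₀ F₁ D₀ D₁} → F₀ ∼F F₁ → D₀ ∼D D₁ → ∼F-Split (F₀ ∘F embD D₀) (F₁ ∘F embD D₁)

  ∼F-split : ∀ {F F' : FCtx n} → F ∼F F' → ∼F-Split F F'
  ∼F-split □ = pure □
  ∼F-split (appR rv e) with ∼F-split e
  ... | pure ee   = pure (appR rv ee)
  ... | delim g d = delim (appR rv g) d
  ∼F-split (appL e rt) with ∼F-split e
  ... | pure ee   = pure (appL ee rt)
  ... | delim g d = delim (appL g rt) d
  ∼F-split (rst e) with ∼F-split e
  ... | pure ee   = delim □ (rst ee)
  ... | delim g d = delim (rst g) d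
  ∼F-split (cv γ e) with ∼F-split e
  ... | pure ee   = delim □ (cv γ ee)
  ... | delim g d = delim (cv γ g) d
  ∼F-split (α∼κ e) with ∼F-split e
  ... | pure ee   = delim □ (α∼κ ee)
  ... | delim g d = delim (α∼κ g) d

  pureCtx-∼F : ∀ {F'} → PureCtx F → F ∼F F' → PureCtx F'
  pureCtx-∼F □   □         = □
  pureCtx-∼F rst (rst e)   = rst
  pureCtx-∼F cv  (cv γ e)  = cv
  pureCtx-∼F cv  (α∼κ e)   = rst

  R : TRel
  R p₀ p₁ = Pure p₀ × Pure p₁ × ∃ λ q → p₁ ⟶* q × p₀ ∼ q

  ∼V⇒ExtV : v ∼V w → ExtV R v w
  ∼V⇒ExtV rv γ _ _ = cv _ _ , cv _ _ , _ , ε , ~cv γ (~app (~val (∼V-renV suc rv)) ∼-x₀)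

  ∼V⇒ExtV-flip : v ∼V w → ExtV (flipR R) w v
  ∼V⇒ExtV-flip rv γ fw fv = ∼V⇒ExtV rv γ fv fw

  R-rst-x₀ : R (rst (x₀ {n})) (rst x₀)
  R-rst-x₀ = rst _ , rst _ , _ , ε , ~rst ∼-x₀

  ∼D⇒R : ∀ {D D' : DCtx n} → D ∼D D' → R (plugD (wkD D) x₀) (plugD (wkD D') x₀)
  ∼D⇒R {D = D} {D'} d = pure-plugD (wkD D) x₀ , pure-plugD (wkD D') x₀ , _ , ε , ∼-plugD-x₀ d

  ∼F⇒R : ∀ {F' : FCtx n} → PureCtx F → F ∼F F' → R (plugF (wkF F) x₀) (plugF (wkF F') x₀)
  ∼F⇒R p e = pureCtx-plugF (pureCtx-renF suc p) (val _) ,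
             pureCtx-plugF (pureCtx-renF suc (pureCtx-∼F p e)) (val _) , _ , ε , ∼-plugF-x₀ e

  ∼F⁺⇒R : ∀ {F' : FCtx n} → PureCtx F → F ∼F⁺ F' → R (plugF (wkF F) x₀) (plugF (wkF F') x₀)
  ∼F⁺⇒R p (exact e) = ∼F⇒R p e
  ∼F⁺⇒R p (extra-rst {F' = F'} e) =
    pureCtx-plugF (pureCtx-renF suc p) (val _) ,
    pureCtx-plugF (pureCtx-renF suc (pureCtx-∘rst (pureCtx-∼F p e))) (val _) ,
    _ , wkF-∘F-rst-⟶* F' , ∼-plugF-x₀ e

  ∼F⇒ExtC : ∀ {F'} → Pure (plugF F (app a b)) → F ∼F F' → ExtC R F F'
  ∼F⇒ExtC p e with ∼F-split e
  ... | pure {E = E} _ = ⊥-elim (¬pure-plugE-app E p)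
  ... | delim {F₀ = F₀} {D₀ = D₀} g d =
    _ , _ , _ , _ , refl , refl , ∼D⇒R d ,
    ∼F⇒R (pureCtx-∘F⁻ F₀ (embD D₀) (plugF-pure⇒pureCtx (F₀ ∘F embD D₀) p)) g

  R-step→ : R p₀ p₁ → p₀ ⟶ p₀' → ∃ λ p₁' → p₁ ⟶* p₁' × R p₀' p₁'
  R-step→ (pp₀ , _ , _ , sts , r) st with step-→ r (⟶⇒↦ st)
  ... | q' , sts' , r' = q' , sts ◅◅ sts' , pp₀' , ∼-pure pp₀' r' , q' , ε , r'
    where pp₀' = pure-↦ pp₀ (⟶⇒↦ st)

  R-value→ : R p₀ p₁ → p₀ ≡ val v → ∃ λ w → p₁ ⇓ val w × ExtV R v w
  R-value→ (_ , _ , _ , sts , ~val rv) refl = _ , (sts , inj₁ (_ , refl)) , ∼V⇒ExtV rv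

  R-contextStuck→ : R p₀ p₁ → p₀ ≡ plugF F₀ (cv γ (val v)) →
    Σ (FCtx n) λ F₁ → Σ (Val n) λ w → p₁ ⇓ plugF F₁ (cv γ (val w))
      × ExtC R (F₀ ∘F rst □) (F₁ ∘F rst □) × ExtV R v w
  R-contextStuck→ {F₀ = F₀} (pp₀ , _ , _ , sts , r) refl
    with contextStuck-→ (plugged-plugF F₀ _) r
  ... | F' , w , rv , e , inj₁ refl =
    F' , w , (sts , contextStuck-NF) ,
    ExtC-∘F-rst {R = R} R-rst-x₀ (∼F⇒R (plugF-pure⇒pureCtx F₀ pp₀) e) , ∼V⇒ExtV rv
  ... | F' , w , rv , e , inj₂ (refl , sts') =
    F' ∘F rst □ , w ,
    (subst (_ ⟶*_) (sym (plugF-∘F F' (rst □) _)) (sts ◅◅ sts') , contextStuck-NF) ,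
    ExtC-∘F-rst {R = R} R-rst-x₀ (∼F⁺⇒R (plugF-pure⇒pureCtx F₀ pp₀) (extra-rst e)) , ∼V⇒ExtV rv

  R-openStuck→ : R p₀ p₁ → p₀ ≡ plugF F₀ (app (val (var y)) (val v)) →
    Σ (FCtx n) λ F₁ → Σ (Val n) λ w → p₁ ⇓ plugF F₁ (app (val (var y)) (val w))
      × ExtC R F₀ F₁ × ExtV R v w
  R-openStuck→ {F₀ = F₀} (pp₀ , _ , _ , sts , r) refl
    with openStuck-→ (plugged-plugF F₀ _) r
  ... | F' , w , rv , e , refl = F' , w , (sts , openStuck-NF) , ∼F⇒ExtC pp₀ e , ∼V⇒ExtV rv

  R-step← : R p₁ p₀ → p₀ ⟶ p₀' → ∃ λ p₁' → p₁ ⟶* p₁' × R p₁' p₀'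
  R-step← (pp₁ , pp₀ , _ , ε , r) st with step-← r (⟶⇒↦ st)
  ... | p₁' , sts , r' = p₁' , sts , pure-⟶* pp₁ sts , pure-↦ pp₀ (⟶⇒↦ st) , _ , ε , r'
  R-step← (pp₁ , pp₀ , _ , st' ◅ sts , r) st with ↦-deterministic (⟶⇒↦ st) (⟶⇒↦ st')
  ... | refl = _ , ε , pp₁ , pure-↦ pp₀ (⟶⇒↦ st) , _ , sts , r

  R-value← : R p₁ p₀ → p₀ ≡ val v → ∃ λ w → p₁ ⇓ val w × ExtV (flipR R) v w
  R-value← (_ , _ , _ , sts , r) refl with irreducible-⟶* (λ ()) sts
  ... | refl with r
  ... | ~val rv = _ , (ε , inj₁ (_ , refl)) , ∼V⇒ExtV-flip rv

  R-contextStuck← : R p₁ p₀ → p₀ ≡ plugF F₀ (cv γ (val v)) →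
    Σ (FCtx n) λ F₁ → Σ (Val n) λ w → p₁ ⇓ plugF F₁ (cv γ (val w))
      × ExtC (flipR R) (F₀ ∘F rst □) (F₁ ∘F rst □) × ExtV (flipR R) v w
  R-contextStuck← {F₀ = F₀} (pp₁ , _ , _ , sts , r) refl
    with irreducible-⟶* (contextStuck-irreducible F₀) sts
  ... | refl with contextStuck-← (plugged-plugF F₀ _) r
  ... | F , w , refl , rv , e =
    F , w , (ε , contextStuck-NF) ,
    ExtC-∘F-rst {R = flipR R} R-rst-x₀ (∼F⁺⇒R (plugF-pure⇒pureCtx F pp₁) e) , ∼V⇒ExtV-flip rv

  R-openStuck← : R p₁ p₀ → p₀ ≡ plugF F₀ (app (val (var y)) (val v)) →
    Σ (FCtx n) λ F₁ → Σ (Val n) λ w → p₁ ⇓ plugF F₁ (app (val (var y)) (val w))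
      × ExtC (flipR R) F₀ F₁ × ExtV (flipR R) v w
  R-openStuck← {F₀ = F₀} (pp₁ , _ , _ , sts , r) refl
    with irreducible-⟶* (openStuck-irreducible F₀) sts
  ... | refl with openStuck-← (plugged-plugF F₀ _) r
  ... | F , w , refl , rv , e =
    F , w , (ε , openStuck-NF) , ExtC-flip {R = R} (∼F⇒ExtC pp₁ e) , ∼V⇒ExtV-flip rv

  R-isPureNFBisim : IsPureNFBisim R
  R-isPureNFBisim =
    (λ (p₀ , p₁ , _) → p₀ , p₁) ,
    (λ r → R-step→ r , R-value→ r , R-contextStuck→ r , R-openStuck→ r) ,
    (λ r → R-step← r , R-value← r , R-contextStuck← r , R-openStuck← r)

  shift-app-⟶ : (t : Tm n) → cv α (sft (app x₀ (wkT t))) ⟶ κ⟨ t ⟩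
  shift-app-⟶ t =
    subst (cv α (sft (app x₀ (wkT t))) ⟶_) (cong κ⟨_⟩ (wkT-[]₀ t κ))
      (shift □ (cv α □) (app x₀ (wkT t)))

  R-shift-app : (t : Tm n) → R (cv α t) (cv α (sft (app x₀ (wkT t))))
  R-shift-app t = cv _ _ , cv _ _ , κ⟨ t ⟩ , shift-app-⟶ t ◅ ε , α∼κ (∼-refl t)

proposition6p30 : ∀ {n} (t : Tm n) → Plain t →
                    t ≈ₒ sft (app (val (var zero)) (wkT t))
proposition6p30 t _ α _ _ = R , R-isPureNFBisim , R-shift-app t
  where open Bisimulation α
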